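{- Let $H(x,y)=\sum_{n\geq 1}\sum_{k\geq 1}\gamma_k(C_n)\,x^n y^k$, a formal power series. Then \[ H(x,y)=\frac{x(1+2x+3x^2)y}{1-(x+x^2+x^3)y}. \]
   Context: For a (multi)graph $G$, a set $D$ of vertices is dominating if every vertex not in $D$ is adjacent to some vertex of $D$; $\gamma_k(G)$ is the number of dominating sets of cardinality exactly $k$ (zero if $k$ exceeds the number of vertices). $C_n$ is the cycle with $n$ vertices for $n\geq 3$; by convention $C_1=K_1$ (a single vertex) and $C_2$ is the dicycle (two vertices joined by two parallel edges), so $\gamma_1(C_1)=1$, $\gamma_1(C_2)=2$, $\gamma_2(C_2)=1$. -}

module Defs where

open import Data.Nat using (ℕ; zero; suc; _%_)
open import Data.Nat.Properties using (_≟_)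
open import Data.Integer using (ℤ; +_; -[1+_]; 0ℤ) renaming (_+_ to _+ℤ_; _*_ to _*ℤ_)
open import Data.Fin using (Fin; toℕ)
open import Data.Fin.Properties using (all?; any?)
open import Data.Fin.Subset using (Subset; _∈_; ∣_∣; inside; outside)
open import Data.Fin.Subset.Properties using (_∈?_)
open import Data.Vec using (_∷_; [])
open import Data.List using (List; []; _∷_; map; _++_; filter; length)
open import Data.Product using (Σ; ∃; _×_; _,_)
open import Data.Sum using (_⊎_)
open import Relation.Binary.PropositionalEquality using (_≡_)
open import Relation.Nullary using (Dec)
open import Relation.Nullary.Decidable using (_⊎-dec_; _×-dec_)

-- The cycle C_n on vertex set Fin n (n ≥ 1), as an adjacency relation.
-- u ~ v iff v ≡ u+1 (mod n) or u ≡ v+1 (mod n).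
-- n ≥ 3: the usual cycle; n = 2: vertices 0,1 adjacent (the dicycle; edge
-- multiplicity is irrelevant to domination); n = 1: K_1 (the relation
-- yields a loop at the single vertex, irrelevant to domination).

CycleAdj : (m : ℕ) → Fin (suc m) → Fin (suc m) → Set
CycleAdj m u v = (toℕ v ≡ suc (toℕ u) % suc m) ⊎ (toℕ u ≡ suc (toℕ v) % suc m)

cycleAdj? : (m : ℕ) → (u v : Fin (suc m)) → Dec (CycleAdj m u v)
cycleAdj? m u v = (toℕ v ≟ suc (toℕ u) % suc m) ⊎-dec (toℕ u ≟ suc (toℕ v) % suc m)

Dominating : {n : ℕ} → (Fin n → Fin n → Set) → Subset n → Set
Dominating {n} Adj D = (v : Fin n) → (v ∈ D) ⊎ ∃ (λ u → (u ∈ D) × Adj u v)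

dominating? : {n : ℕ} (Adj : Fin n → Fin n → Set) →
              ((u v : Fin n) → Dec (Adj u v)) → (D : Subset n) → Dec (Dominating Adj D)
dominating? Adj adj? D = all? (λ v → (v ∈? D) ⊎-dec any? (λ u → (u ∈? D) ×-dec adj? u v))

allSubsets : (n : ℕ) → List (Subset n)
allSubsets zero = [] ∷ []
allSubsets (suc n) = map (inside ∷_) (allSubsets n) ++ map (outside ∷_) (allSubsets n)

-- γ_k(C_n) for n = suc m: number of dominating sets of cardinality exactly k.
γC : (k m : ℕ) → ℕ
γC k m = length (filter (λ D → (∣ D ∣ ≟ k) ×-dec dominating? (CycleAdj m) (cycleAdj? m) D)
                        (allSubsets (suc m)))

FPS : Set
FPS = ℕ → ℕ → ℤ   -- f n k = coefficient of x^n y^k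

sumTo : ℕ → (ℕ → ℤ) → ℤ
sumTo zero f = f 0
sumTo (suc n) f = sumTo n f +ℤ f (suc n)

_⊗_ : FPS → FPS → FPS
(f ⊗ g) n k = sumTo n (λ i → sumTo k (λ j → f i j *ℤ g (n Data.Nat.∸ i) (k Data.Nat.∸ j)))

H : FPS
H zero k = 0ℤ
H (suc m) zero = 0ℤ
H (suc m) (suc j) = + γC (suc j) m

Num : FPS
Num 1 1 = + 1
Num 2 1 = + 2
Num 3 1 = + 3
Num _ _ = 0ℤ

Den : FPS
Den 0 0 = + 1
Den 1 1 = -[1+ 0 ]
Den 2 1 = -[1+ 0 ]
Den 3 1 = -[1+ 0 ]
Den _ _ = 0ℤ

module Submission where

-- A vertex set D of C_n dominates iff every three cyclically consecutive
-- vertices meet D, i.e. iff its cyclic Boolean word has no three consecutive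
-- falses.  With the first two letters fixed, such words are counted by a
-- transfer system on the last two letters read, whose counts satisfy
-- X_{l+3} = y (X_{l+2} + X_{l+1} + X_l).  Hence
-- γ(C_n) = y (γ(C_{n-1}) + γ(C_{n-2}) + γ(C_{n-3})) for n ≥ 5, which is the
-- denominator; the cycles with n ≤ 4 give the numerator.

open import Defs
open import Data.Bool using (Bool; true; false; _∧_; _∨_; if_then_else_; T)
open import Data.Bool.Properties using (T-∧; T-∨; T-≡; ∨-zeroʳ; ∨-identityʳ; ∧-zeroʳ)
open import Data.Fin using (Fin; zero; suc; toℕ; fromℕ; fromℕ<; inject₁)
open import Data.Fin.Properties using (toℕ-injective; toℕ-fromℕ<; toℕ-fromℕ; toℕ-inject₁; toℕ<n)
open import Data.Fin.Subset using (Subset; _∈_; ∣_∣; inside; outside)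
open import Data.Integer using (ℤ; +_; -_; 0ℤ; 1ℤ; -1ℤ)
  renaming (_+_ to _+ℤ_; _*_ to _*ℤ_; _-_ to _-ℤ_)
open import Data.Integer.Properties using (pos-+) renaming (+-identityˡ to +ℤ-identityˡ)
open import Data.Integer.Tactic.RingSolver using (solve-∀)
open import Data.List using (List; []; _∷_; _++_; map; filter; length)
open import Data.List.Properties using (filter-++; length-++)
open import Data.Nat using (ℕ; zero; suc; _+_; _∸_; _%_; _≤_; z≤n; s≤s)
open import Data.Nat.Properties
  using (_≟_; _<?_; ≮⇒≥; ≤∧≢⇒<; suc-injective; +-identityʳ; +-comm; +-suc;
         m≤n⇒∃[o]m+o≡n; ≤-refl; m≤n⇒m≤1+n; +-∸-assoc; n∸n≡0)
open import Data.Nat.DivMod using (m%n<n; n%n≡0; m<n⇒m%n≡m)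
import Data.Nat.Tactic.RingSolver as ℕ-Solver
open import Data.Product using (∃; _×_; _,_; proj₁; proj₂)
open import Data.Sum using (_⊎_; inj₁; inj₂)
open import Data.Unit using (tt)
open import Data.Vec using (Vec; []; _∷_; lookup; toList)
open import Data.Vec.Properties using ([]=⇒lookup; lookup⇒[]=)
open import Function using (_∘_; _⇔_; mk⇔; Equivalence)
open import Function.Construct.Composition using (_⇔-∘_)
open import Function.Construct.Symmetry using (⇔-sym)
open import Relation.Binary.PropositionalEquality
  using (_≡_; refl; sym; trans; cong; cong₂; subst; module ≡-Reasoning)
open import Relation.Nullary using (does; proof; yes; no)
open import Relation.Nullary.Reflects using (fromEquivalence; det)
open import Relation.Unary using (Pred; Decidable)

open Equivalence using (to; from)

-- Counting over Boolean words

count : (n : ℕ) → (Vec Bool n → Bool) → ℕ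
count zero    f = if f [] then 1 else 0
count (suc n) f = count n (f ∘ (true ∷_)) + count n (f ∘ (false ∷_))

count-cong : ∀ n {f g : Vec Bool n → Bool} → (∀ v → f v ≡ g v) → count n f ≡ count n g
count-cong zero    f≡g rewrite f≡g [] = refl
count-cong (suc n) f≡g =
  cong₂ _+_ (count-cong n (f≡g ∘ (true ∷_))) (count-cong n (f≡g ∘ (false ∷_)))

count-false : ∀ n → count n (λ _ → false) ≡ 0
count-false zero    = refl
count-false (suc n) rewrite count-false n = refl

count-guard : ∀ n (c : Bool) (f g : Vec Bool n → Bool) →
  count n (λ v → f v ∧ (c ∧ g v)) ≡ (if c then count n (λ v → f v ∧ g v) else 0)
count-guard n true  f g = refl
count-guard n false f g = trans (count-cong n (λ v → ∧-zeroʳ (f v))) (count-false n)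

length-filter-map : ∀ {A B : Set} {ℓ} {P : Pred B ℓ} (P? : Decidable P) (f : A → B) xs →
  length (filter P? (map f xs)) ≡ length (filter (P? ∘ f) xs)
length-filter-map P? f [] = refl
length-filter-map P? f (x ∷ xs) with does (P? (f x))
... | true  = cong suc (length-filter-map P? f xs)
... | false = length-filter-map P? f xs

length-filter-allSubsets : ∀ n {ℓ} {P : Pred (Subset n) ℓ} (P? : Decidable P) →
  length (filter P? (allSubsets n)) ≡ count n (does ∘ P?)
length-filter-allSubsets zero P? with does (P? [])
... | true  = refl
... | false = refl
length-filter-allSubsets (suc n) P? = begin
    length (filter P? (map (inside ∷_) S ++ map (outside ∷_) S))
  ≡⟨ cong length (filter-++ P? (map (inside ∷_) S) _) ⟩
    length (filter P? (map (inside ∷_) S) ++ filter P? (map (outside ∷_) S))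
  ≡⟨ length-++ (filter P? (map (inside ∷_) S)) ⟩
    length (filter P? (map (inside ∷_) S)) + length (filter P? (map (outside ∷_) S))
  ≡⟨ cong₂ _+_ (trans (length-filter-map P? _ S) (length-filter-allSubsets n _))
               (trans (length-filter-map P? _ S) (length-filter-allSubsets n _)) ⟩
    count (suc n) (does ∘ P?)
  ∎
  where
  open ≡-Reasoning
  S : List (Subset n)
  S = allSubsets n

-- On coefficient sequences in y, shift is multiplication by y.
shift : (ℕ → ℕ) → ℕ → ℕ
shift f zero    = 0
shift f (suc k) = f k

shift-cong : ∀ {f g : ℕ → ℕ} → (∀ k → f k ≡ g k) → ∀ k → shift f k ≡ shift g k
shift-cong f≡g zero    = refl
shift-cong f≡g (suc k) = f≡g k

shift-+ : ∀ (f g : ℕ → ℕ) k → shift (λ j → f j + g j) k ≡ shift f k + shift g k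
shift-+ f g zero    = refl
shift-+ f g (suc k) = refl

count-shift : ∀ l (s : Vec Bool l → ℕ) (g : Vec Bool l → Bool) k →
  count l (λ r → does (suc (s r) ≟ k) ∧ g r) ≡ shift (λ j → count l (λ r → does (s r ≟ j) ∧ g r)) k
count-shift l s g zero    = count-false l
count-shift l s g (suc k) = refl

noThreeFalse : List Bool → Bool
noThreeFalse (a ∷ b ∷ c ∷ xs) = (a ∨ b ∨ c) ∧ noThreeFalse (b ∷ c ∷ xs)
noThreeFalse _                = true

-- Reading past the end of a word gives true.
at : List Bool → ℕ → Bool
at []       i       = true
at (x ∷ xs) zero    = x
at (x ∷ xs) (suc i) = at xs i

window : List Bool → ℕ → Bool
window xs i = at xs i ∨ at xs (suc i) ∨ at xs (suc (suc i))

T-∨₃ : ∀ x y z → T (x ∨ y ∨ z) ⇔ (T x ⊎ T y ⊎ T z)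
T-∨₃ x y z = mk⇔ to′ from′
  where
  to′ : T (x ∨ y ∨ z) → T x ⊎ T y ⊎ T z
  to′ t with to (T-∨ {x}) t
  ... | inj₁ tx  = inj₁ tx
  ... | inj₂ tyz = inj₂ (to (T-∨ {y}) tyz)
  from′ : T x ⊎ T y ⊎ T z → T (x ∨ y ∨ z)
  from′ (inj₁ tx)        = from (T-∨ {x}) (inj₁ tx)
  from′ (inj₂ (inj₁ ty)) = from (T-∨ {x}) (inj₂ (from (T-∨ {y}) (inj₁ ty)))
  from′ (inj₂ (inj₂ tz)) = from (T-∨ {x}) (inj₂ (from (T-∨ {y}) (inj₂ tz)))

noThreeFalse⇔windows : ∀ xs → T (noThreeFalse xs) ⇔ (∀ i → T (window xs i))
noThreeFalse⇔windows xs = mk⇔ (windows xs) (noThreeFalse-from-windows xs)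
  where
  windows : ∀ xs → T (noThreeFalse xs) → ∀ i → T (window xs i)
  windows []               _ i             = tt
  windows (a ∷ [])         _ zero          = from (T-∨₃ a true true) (inj₂ (inj₁ tt))
  windows (a ∷ [])         _ (suc i)       = tt
  windows (a ∷ b ∷ [])     _ zero          = from (T-∨₃ a b true) (inj₂ (inj₂ tt))
  windows (a ∷ b ∷ [])     _ (suc zero)    = from (T-∨₃ b true true) (inj₂ (inj₁ tt))
  windows (a ∷ b ∷ [])     _ (suc (suc i)) = tt
  windows (a ∷ b ∷ c ∷ xs) t zero          = proj₁ (to T-∧ t)
  windows (a ∷ b ∷ c ∷ xs) t (suc i)       =
    windows (b ∷ c ∷ xs) (proj₂ (to (T-∧ {a ∨ b ∨ c}) t)) i
  noThreeFalse-from-windows : ∀ xs → (∀ i → T (window xs i)) → T (noThreeFalse xs)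
  noThreeFalse-from-windows (a ∷ b ∷ c ∷ xs) w =
    from (T-∧ {window (a ∷ b ∷ c ∷ xs) 0}) (w 0 , noThreeFalse-from-windows (b ∷ c ∷ xs) (w ∘ suc))
  noThreeFalse-from-windows []           w = tt
  noThreeFalse-from-windows (a ∷ [])     w = tt
  noThreeFalse-from-windows (a ∷ b ∷ []) w = tt

-- Domination on the cycle

csuc : ∀ {m} → Fin (suc m) → Fin (suc m)
csuc {m} v = fromℕ< (m%n<n (suc (toℕ v)) (suc m))

toℕ-csuc : ∀ {m} (v : Fin (suc m)) → toℕ (csuc v) ≡ suc (toℕ v) % suc m
toℕ-csuc {m} v = toℕ-fromℕ< (m%n<n (suc (toℕ v)) (suc m))

csuc-cases : ∀ {m} (v : Fin (suc m)) → toℕ (csuc v) ≡ suc (toℕ v) ⊎ (toℕ v ≡ m × csuc v ≡ zero)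
csuc-cases {m} v with toℕ v ≟ m | toℕ<n v
... | yes v≡m | _ = inj₂ (v≡m , toℕ-injective (trans (toℕ-csuc v) wraps))
  where
  wraps : suc (toℕ v) % suc m ≡ 0
  wraps rewrite v≡m = n%n≡0 (suc m)
... | no v≢m | s≤s v≤m = inj₁ (trans (toℕ-csuc v) (m<n⇒m%n≡m (s≤s (≤∧≢⇒< v≤m v≢m))))

csuc-injective : ∀ {m} {u v : Fin (suc m)} → csuc u ≡ csuc v → u ≡ v
csuc-injective {m} {u} {v} eq with csuc-cases u | csuc-cases v
... | inj₁ u′ | inj₁ v′ = toℕ-injective (suc-injective (trans (sym u′) (trans (cong toℕ eq) v′)))
... | inj₁ u′ | inj₂ (_ , v′) with () ← trans (sym u′) (cong toℕ (trans eq v′))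
... | inj₂ (_ , u′) | inj₁ v′ with () ← trans (sym v′) (cong toℕ (trans (sym eq) u′))
... | inj₂ (u≡m , _) | inj₂ (v≡m , _) = toℕ-injective (trans u≡m (sym v≡m))

cpred : ∀ {m} → Fin (suc m) → Fin (suc m)
cpred {m}     zero    = fromℕ m
cpred {suc m} (suc v) = inject₁ v

csuc-cpred : ∀ {m} (v : Fin (suc m)) → csuc (cpred v) ≡ v
csuc-cpred {m} zero = toℕ-injective (begin
    toℕ (csuc (fromℕ m))        ≡⟨ toℕ-csuc (fromℕ m) ⟩
    suc (toℕ (fromℕ m)) % suc m ≡⟨ cong (λ i → suc i % suc m) (toℕ-fromℕ m) ⟩
    suc m % suc m               ≡⟨ n%n≡0 (suc m) ⟩
    0                           ∎)
  where open ≡-Reasoning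
csuc-cpred {suc m} (suc v) = toℕ-injective (begin
    toℕ (csuc (inject₁ v))              ≡⟨ toℕ-csuc (inject₁ v) ⟩
    suc (toℕ (inject₁ v)) % suc (suc m) ≡⟨ cong (λ i → suc i % suc (suc m)) (toℕ-inject₁ v) ⟩
    suc (toℕ v) % suc (suc m)           ≡⟨ m<n⇒m%n≡m (s≤s (toℕ<n v)) ⟩
    suc (toℕ v)                         ∎)
  where open ≡-Reasoning

CycleAdj⇒csuc : ∀ {m} {u v : Fin (suc m)} → CycleAdj m u v → v ≡ csuc u ⊎ u ≡ csuc v
CycleAdj⇒csuc {u = u} (inj₁ v≡) = inj₁ (toℕ-injective (trans v≡ (sym (toℕ-csuc u))))
CycleAdj⇒csuc {v = v} (inj₂ u≡) = inj₂ (toℕ-injective (trans u≡ (sym (toℕ-csuc v))))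

CycleAdj-csucʳ : ∀ {m} (u : Fin (suc m)) → CycleAdj m u (csuc u)
CycleAdj-csucʳ u = inj₁ (toℕ-csuc u)

CycleAdj-csucˡ : ∀ {m} (v : Fin (suc m)) → CycleAdj m (csuc v) v
CycleAdj-csucˡ v = inj₂ (toℕ-csuc v)

∈⇒T : ∀ {n} {v : Fin n} {D : Subset n} → v ∈ D → T (lookup D v)
∈⇒T v∈D = from T-≡ ([]=⇒lookup v∈D)

T⇒∈ : ∀ {n} {v : Fin n} {D : Subset n} → T (lookup D v) → v ∈ D
T⇒∈ {v = v} {D} t = lookup⇒[]= v D (to T-≡ t)

MeetsTriples : ∀ {m} → Subset (suc m) → Set
MeetsTriples D = ∀ v → T (lookup D v ∨ lookup D (csuc v) ∨ lookup D (csuc (csuc v)))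

-- csuc v is dominated exactly when D meets {v, csuc v, csuc (csuc v)}.
dominating⇔meetsTriples : ∀ {m} (D : Subset (suc m)) → Dominating (CycleAdj m) D ⇔ MeetsTriples D
dominating⇔meetsTriples {m} D = mk⇔ meets dominates
  where
  meets : Dominating (CycleAdj m) D → MeetsTriples D
  meets dom v = from (T-∨₃ (lookup D v) (lookup D (csuc v)) (lookup D (csuc (csuc v))))
                     (dominator (dom (csuc v)))
    where
    dominator : (csuc v ∈ D) ⊎ ∃ (λ u → u ∈ D × CycleAdj m u (csuc v)) →
                T (lookup D v) ⊎ T (lookup D (csuc v)) ⊎ T (lookup D (csuc (csuc v)))
    dominator (inj₁ w∈D) = inj₂ (inj₁ (∈⇒T w∈D))
    dominator (inj₂ (u , u∈D , adj)) with CycleAdj⇒csuc adj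
    ... | inj₁ w≡ = inj₁ (∈⇒T (subst (_∈ D) (csuc-injective (sym w≡)) u∈D))
    ... | inj₂ u≡ = inj₂ (inj₂ (∈⇒T (subst (_∈ D) u≡ u∈D)))
  dominates : MeetsTriples D → Dominating (CycleAdj m) D
  dominates meet w with cpred w | csuc-cpred w
  ... | u | refl with to (T-∨₃ (lookup D u) (lookup D (csuc u)) (lookup D (csuc (csuc u)))) (meet u)
  ...   | inj₁ t        = inj₂ (u , T⇒∈ t , CycleAdj-csucʳ u)
  ...   | inj₂ (inj₁ t) = inj₁ (T⇒∈ t)
  ...   | inj₂ (inj₂ t) = inj₂ (csuc (csuc u) , T⇒∈ t , CycleAdj-csucˡ (csuc u))

-- Appending D₀ D₁ makes every cyclic triple a window of the linear word.
wrap : ∀ {m} → Subset (suc m) → List Bool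
wrap D = toList D ++ lookup D zero ∷ lookup D (csuc zero) ∷ []

at-toList : ∀ {n} (D : Vec Bool n) (v : Fin n) ys → at (toList D ++ ys) (toℕ v) ≡ lookup D v
at-toList (x ∷ D) zero    ys = refl
at-toList (x ∷ D) (suc v) ys = at-toList D v ys

at-beyond : ∀ {n} (D : Vec Bool n) ys j → at (toList D ++ ys) (n + j) ≡ at ys j
at-beyond []      ys j = refl
at-beyond (x ∷ D) ys j = at-beyond D ys j

at-wrap-suc : ∀ {m} (D : Subset (suc m)) v → at (wrap D) (suc (toℕ v)) ≡ lookup D (csuc v)
at-wrap-suc {m} D v with csuc-cases v
... | inj₁ eq = trans (cong (at (wrap D)) (sym eq)) (at-toList D (csuc v) _)
... | inj₂ (v≡m , w≡0) rewrite v≡m | w≡0 =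
  trans (cong (at (wrap D)) (sym (+-identityʳ (suc m)))) (at-beyond D _ 0)

at-wrap-suc² : ∀ {m} (D : Subset (suc m)) v → at (wrap D) (suc (suc (toℕ v))) ≡ lookup D (csuc (csuc v))
at-wrap-suc² {m} D v with csuc-cases v
... | inj₁ eq = trans (cong (at (wrap D) ∘ suc) (sym eq)) (at-wrap-suc D (csuc v))
... | inj₂ (v≡m , w≡0) rewrite v≡m | w≡0 =
  trans (cong (at (wrap D)) (+-comm 1 (suc m))) (at-beyond D _ 1)

window-wrap : ∀ {m} (D : Subset (suc m)) v →
  window (wrap D) (toℕ v) ≡ lookup D v ∨ lookup D (csuc v) ∨ lookup D (csuc (csuc v))
window-wrap D v = cong₂ _∨_ (at-toList D v _) (cong₂ _∨_ (at-wrap-suc D v) (at-wrap-suc² D v))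

window-wrap-beyond : ∀ {m} (D : Subset (suc m)) j → T (window (wrap D) (suc m + j))
window-wrap-beyond {m} D j =
  from (T-∨₃ (at (wrap D) (suc m + j)) (at (wrap D) (suc (suc m + j))) _) (inj₂ (inj₂ third))
  where
  third : T (at (wrap D) (suc (suc (suc m + j))))
  third rewrite sym (+-suc (suc m) j) | sym (+-suc (suc m) (suc j)) =
    subst T (sym (at-beyond D _ (suc (suc j)))) tt

meetsTriples⇔windows : ∀ {m} (D : Subset (suc m)) → MeetsTriples D ⇔ (∀ i → T (window (wrap D) i))
meetsTriples⇔windows {m} D = mk⇔ windows (λ w v → subst T (window-wrap D v) (w (toℕ v)))
  where
  windows : MeetsTriples D → ∀ i → T (window (wrap D) i)
  windows meet i with i <? suc m
  ... | yes i<n = subst (T ∘ window (wrap D)) (toℕ-fromℕ< i<n)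
                        (subst T (sym (window-wrap D (fromℕ< i<n))) (meet (fromℕ< i<n)))
  ... | no i≮n with m≤n⇒∃[o]m+o≡n (≮⇒≥ i≮n)
  ...   | j , refl = window-wrap-beyond D j

does-dominating? : ∀ m (D : Subset (suc m)) →
  does (dominating? (CycleAdj m) (cycleAdj? m) D) ≡ noThreeFalse (wrap D)
does-dominating? m D = det (proof (dominating? (CycleAdj m) (cycleAdj? m) D))
                           (fromEquivalence (from dominating⇔noThreeFalse) (to dominating⇔noThreeFalse))
  where
  dominating⇔noThreeFalse : Dominating (CycleAdj m) D ⇔ T (noThreeFalse (wrap D))
  dominating⇔noThreeFalse =
    ⇔-sym (noThreeFalse⇔windows (wrap D)) ⇔-∘ (meetsTriples⇔windows D ⇔-∘ dominating⇔meetsTriples D)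

-- Transfer counts

fillings : ℕ → Bool → Bool → Bool → Bool → ℕ → ℕ
fillings zero    p q a b k = if does (0 ≟ k) ∧ noThreeFalse (p ∷ q ∷ a ∷ b ∷ []) then 1 else 0
fillings (suc l) p q a b k =
  shift (fillings l q true a b) k + (if p ∨ q then fillings l q false a b k else 0)

admissible : ∀ {l} → Bool → Bool → Bool → Bool → ℕ → Vec Bool l → Bool
admissible p q a b k r = does (∣ r ∣ ≟ k) ∧ noThreeFalse (p ∷ q ∷ toList r ++ a ∷ b ∷ [])

count-admissible : ∀ l p q a b k → count l (admissible p q a b k) ≡ fillings l p q a b k
count-admissible zero    p q a b k = refl
count-admissible (suc l) p q a b k = cong₂ _+_ first-true first-false
  where
  rest : Bool → Vec Bool l → Bool
  rest c r = noThreeFalse (q ∷ c ∷ toList r ++ a ∷ b ∷ [])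
  first-true : count l (λ r → does (suc ∣ r ∣ ≟ k) ∧ ((p ∨ q ∨ true) ∧ rest true r))
               ≡ shift (fillings l q true a b) k
  first-true rewrite ∨-zeroʳ q | ∨-zeroʳ p =
    trans (count-shift l ∣_∣ (rest true) k) (shift-cong (count-admissible l q true a b) k)
  first-false : count l (λ r → does (∣ r ∣ ≟ k) ∧ ((p ∨ q ∨ false) ∧ rest false r))
                ≡ (if p ∨ q then fillings l q false a b k else 0)
  first-false rewrite ∨-identityʳ q =
    trans (count-guard l (p ∨ q) _ (rest false))
          (cong (λ n → if p ∨ q then n else 0) (count-admissible l q false a b k))

-- The first letter only enters the triple p q r₀, which q = true already covers.
fillings-ignores-first : ∀ l a b k → fillings l false true a b k ≡ fillings l true true a b k
fillings-ignores-first zero    a b k = refl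
fillings-ignores-first (suc l) a b k = refl

Recurrent : (ℕ → ℕ → ℕ) → Set
Recurrent X = ∀ l k → X (3 + l) k ≡ shift (X (2 + l)) k + (shift (X (1 + l)) k + shift (X l) k)

recurrent-shift : ∀ {X} → Recurrent X → Recurrent (λ l → shift (X l))
recurrent-shift rec l zero    = refl
recurrent-shift rec l (suc k) = rec l k

recurrent-+ : ∀ {X Y} → Recurrent X → Recurrent Y → Recurrent (λ l k → X l k + Y l k)
recurrent-+ recX recY l zero    = cong₂ _+_ (recX l 0) (recY l 0)
recurrent-+ {X} {Y} recX recY l (suc k) =
  trans (cong₂ _+_ (recX l (suc k)) (recY l (suc k)))
        (interchange (X (2 + l) k) (X (1 + l) k) (X l k) (Y (2 + l) k) (Y (1 + l) k) (Y l k))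
  where
  interchange : ∀ a b c d e f → (a + (b + c)) + (d + (e + f)) ≡ (a + d) + ((b + e) + (c + f))
  interchange = ℕ-Solver.solve-∀

-- The characteristic polynomial of this transfer system is t³ - y (t² + t + 1).
module Transfer (A B C : ℕ → ℕ → ℕ)
  (A-step : ∀ l k → A (suc l) k ≡ shift (A l) k + B l k)
  (B-step : ∀ l k → B (suc l) k ≡ shift (A l) k + C l k)
  (C-step : ∀ l k → C (suc l) k ≡ shift (A l) k)
  where

  shift-step : ∀ (X Y : ℕ → ℕ → ℕ) → (∀ l k → X (suc l) k ≡ shift (A l) k + Y l k) →
    ∀ l k → shift (X (suc l)) k ≡ shift (shift (A l)) k + shift (Y l) k
  shift-step X Y step l k = trans (shift-cong (step l) k) (shift-+ _ _ k)

  recurrentA : Recurrent A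
  recurrentA l k = trans (A-step (2 + l) k)
    (cong (_+_ (shift (A (2 + l)) k)) (trans (B-step (1 + l) k) (cong (_+_ (shift (A (1 + l)) k)) (C-step l k))))

  recurrentC : Recurrent C
  recurrentC l k = begin
      C (3 + l) k
    ≡⟨ C-step (2 + l) k ⟩
      shift (A (2 + l)) k
    ≡⟨ shift-step A B A-step (1 + l) k ⟩
      shift (shift (A (1 + l))) k + shift (B (1 + l)) k
    ≡⟨ cong (_+_ (shift (shift (A (1 + l))) k)) (shift-step B C B-step l k) ⟩
      shift (shift (A (1 + l))) k + (shift (shift (A l)) k + shift (C l) k)
    ≡⟨ sym (cong₂ (λ x y → x + (y + shift (C l) k))
             (shift-cong (C-step (1 + l)) k) (shift-cong (C-step l) k)) ⟩
      shift (C (2 + l)) k + (shift (C (1 + l)) k + shift (C l) k)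
    ∎
    where open ≡-Reasoning

  recurrentB : Recurrent B
  recurrentB l k = begin
      B (3 + l) k
    ≡⟨ B-step (2 + l) k ⟩
      shift (A (2 + l)) k + C (2 + l) k
    ≡⟨ cong₂ _+_ (shift-step A B A-step (1 + l) k) (C-step (1 + l) k) ⟩
      (a₁ + shift (B (1 + l)) k) + shift (A (1 + l)) k
    ≡⟨ cong₂ (λ x y → (a₁ + x) + y) (shift-step B C B-step l k) (shift-step A B A-step l k) ⟩
      (a₁ + (a₀ + c₀)) + (a₀ + b₀)
    ≡⟨ regroup a₁ a₀ b₀ c₀ ⟩
      (a₁ + a₀) + ((a₀ + c₀) + b₀)
    ≡⟨ sym (cong₂ (λ x y → x + (y + b₀))
             (trans (shift-step B C B-step (1 + l) k) (cong (_+_ a₁) (shift-cong (C-step l) k)))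
             (shift-step B C B-step l k)) ⟩
      shift (B (2 + l)) k + (shift (B (1 + l)) k + b₀)
    ∎
    where
    open ≡-Reasoning
    a₁ a₀ b₀ c₀ : ℕ
    a₁ = shift (shift (A (1 + l))) k
    a₀ = shift (shift (A l)) k
    b₀ = shift (B l) k
    c₀ = shift (C l) k
    regroup : ∀ a₁ a₀ b₀ c₀ → (a₁ + (a₀ + c₀)) + (a₀ + b₀) ≡ (a₁ + a₀) + ((a₀ + c₀) + b₀)
    regroup = ℕ-Solver.solve-∀

module Fillings (a b : Bool) = Transfer
  (λ l → fillings l true true a b) (λ l → fillings l true false a b) (λ l → fillings l false false a b)
  (λ l k → refl)
  (λ l k → cong (_+ fillings l false false a b k) (shift-cong (fillings-ignores-first l a b) k))
  (λ l k → trans (+-identityʳ _) (shift-cong (fillings-ignores-first l a b) k))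

γ : ℕ → ℕ → ℕ
γ zero    k = 0
γ (suc m) k = count (suc m) (λ D → does (∣ D ∣ ≟ k) ∧ noThreeFalse (wrap D))

γC≡γ : ∀ k m → γC k m ≡ γ (suc m) k
γC≡γ k m = trans (length-filter-allSubsets (suc m) _)
                 (count-cong (suc m) (λ D → cong (does (∣ D ∣ ≟ k) ∧_) (does-dominating? m D)))

-- Split D = D₀ ∷ D₁ ∷ r by (D₀, D₁); each true among D₀, D₁ contributes one factor y.
byFirstTwo : ℕ → ℕ → ℕ
byFirstTwo m k = (shift (shift (fillings m true true true true)) k + shift (fillings m true false true false) k)
               + (shift (fillings m true true false true) k + fillings m false false false false k)

γ≡byFirstTwo : ∀ m k → γ (2 + m) k ≡ byFirstTwo m k
γ≡byFirstTwo m k = cong₂ _+_ (cong₂ _+_ both-in first-in) (cong₂ _+_ second-in both-out)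
  where
  cyclic : Bool → Bool → Vec Bool m → Bool
  cyclic p q r = noThreeFalse (p ∷ q ∷ toList r ++ p ∷ q ∷ [])
  both-in : count m (λ r → does (suc (suc ∣ r ∣) ≟ k) ∧ cyclic true true r)
            ≡ shift (shift (fillings m true true true true)) k
  both-in = trans (count-shift m (suc ∘ ∣_∣) (cyclic true true) k)
    (shift-cong (λ j → trans (count-shift m ∣_∣ _ j)
                             (shift-cong (count-admissible m true true true true) j)) k)
  first-in : count m (λ r → does (suc ∣ r ∣ ≟ k) ∧ cyclic true false r)
             ≡ shift (fillings m true false true false) k
  first-in = trans (count-shift m ∣_∣ _ k) (shift-cong (count-admissible m true false true false) k)
  second-in : count m (λ r → does (suc ∣ r ∣ ≟ k) ∧ cyclic false true r)
              ≡ shift (fillings m true true false true) k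
  second-in = trans (count-shift m ∣_∣ _ k)
    (shift-cong (λ j → trans (count-admissible m false true false true j)
                             (fillings-ignores-first m false true j)) k)
  both-out : count m (λ r → does (∣ r ∣ ≟ k) ∧ cyclic false false r) ≡ fillings m false false false false k
  both-out = count-admissible m false false false false k

byFirstTwo-recurrent : Recurrent byFirstTwo
byFirstTwo-recurrent =
  recurrent-+ (recurrent-+ (recurrent-shift (recurrent-shift (Fillings.recurrentA true true)))
                           (recurrent-shift (Fillings.recurrentB true false)))
              (recurrent-+ (recurrent-shift (Fillings.recurrentA false true))
                           (Fillings.recurrentC false false))

γ-recurrence : ∀ t k → γ (5 + t) k ≡ shift (γ (4 + t)) k + (shift (γ (3 + t)) k + shift (γ (2 + t)) k)
γ-recurrence t k = begin
    γ (5 + t) k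
  ≡⟨ γ≡byFirstTwo (3 + t) k ⟩
    byFirstTwo (3 + t) k
  ≡⟨ byFirstTwo-recurrent t k ⟩
    shift (byFirstTwo (2 + t)) k + (shift (byFirstTwo (1 + t)) k + shift (byFirstTwo t) k)
  ≡⟨ sym (cong₂ _+_ (shift-cong (γ≡byFirstTwo (2 + t)) k)
                    (cong₂ _+_ (shift-cong (γ≡byFirstTwo (1 + t)) k) (shift-cong (γ≡byFirstTwo t) k))) ⟩
    shift (γ (4 + t)) k + (shift (γ (3 + t)) k + shift (γ (2 + t)) k)
  ∎
  where open ≡-Reasoning

γ-y⁰ : ∀ n → γ n 0 ≡ 0
γ-y⁰ zero                = refl
γ-y⁰ (suc zero)          = refl
γ-y⁰ (suc (suc zero))    = refl
γ-y⁰ (suc (suc (suc m))) = γ≡byFirstTwo (suc m) 0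

H≡γ : ∀ n k → H n k ≡ + γ n k
H≡γ zero    k       = refl
H≡γ (suc m) zero    = cong +_ (sym (γ-y⁰ (suc m)))
H≡γ (suc m) (suc j) = cong +_ (γC≡γ (suc j) m)

H-y⁰ : ∀ n → H n 0 ≡ 0ℤ
H-y⁰ zero    = refl
H-y⁰ (suc n) = refl

-- For n ≤ 4 the identity is checked by evaluation; these cases make up the numerator.
H-recurrence : ∀ n k →
  H n k ≡ Num n k +ℤ (H (n ∸ 1) (k ∸ 1) +ℤ (H (n ∸ 2) (k ∸ 1) +ℤ H (n ∸ 3) (k ∸ 1)))
H-recurrence 0 k = refl
H-recurrence 1 0 = refl
H-recurrence 1 1 = refl
H-recurrence 1 (suc (suc k)) = refl
H-recurrence 2 0 = refl
H-recurrence 2 1 = refl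
H-recurrence 2 2 = refl
H-recurrence 2 (suc (suc (suc k))) = refl
H-recurrence 3 0 = refl
H-recurrence 3 1 = refl
H-recurrence 3 2 = refl
H-recurrence 3 3 = refl
H-recurrence 3 (suc (suc (suc (suc k)))) = refl
H-recurrence 4 0 = refl
H-recurrence 4 1 = refl
H-recurrence 4 2 = refl
H-recurrence 4 3 = refl
H-recurrence 4 4 = refl
H-recurrence 4 (suc (suc (suc (suc (suc k))))) = refl
H-recurrence (suc (suc (suc (suc (suc t))))) zero = refl
H-recurrence (suc (suc (suc (suc (suc t))))) (suc k) = begin
    H (5 + t) (suc k)
  ≡⟨ H≡γ (5 + t) (suc k) ⟩
    + γ (5 + t) (suc k)
  ≡⟨ cong +_ (γ-recurrence t (suc k)) ⟩
    + (γ (4 + t) k + (γ (3 + t) k + γ (2 + t) k))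
  ≡⟨ trans (pos-+ (γ (4 + t) k) _) (cong (_+ℤ_ (+ γ (4 + t) k)) (pos-+ (γ (3 + t) k) (γ (2 + t) k))) ⟩
    + γ (4 + t) k +ℤ (+ γ (3 + t) k +ℤ + γ (2 + t) k)
  ≡⟨ sym (cong₂ _+ℤ_ (H≡γ (4 + t) k) (cong₂ _+ℤ_ (H≡γ (3 + t) k) (H≡γ (2 + t) k))) ⟩
    H (4 + t) k +ℤ (H (3 + t) k +ℤ H (2 + t) k)
  ≡⟨ sym (+ℤ-identityˡ _) ⟩
    0ℤ +ℤ (H (4 + t) k +ℤ (H (3 + t) k +ℤ H (2 + t) k))
  ∎
  where open ≡-Reasoning

-- Multiplying by the denominator

sumTo-cong : ∀ n {f g : ℕ → ℤ} → (∀ i → i ≤ n → f i ≡ g i) → sumTo n f ≡ sumTo n g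
sumTo-cong zero    f≡g = f≡g 0 z≤n
sumTo-cong (suc n) f≡g =
  cong₂ _+ℤ_ (sumTo-cong n (λ i i≤n → f≡g i (m≤n⇒m≤1+n i≤n))) (f≡g (suc n) ≤-refl)

sumTo-+ : ∀ n (f g : ℕ → ℤ) → sumTo n (λ i → f i +ℤ g i) ≡ sumTo n f +ℤ sumTo n g
sumTo-+ zero    f g = refl
sumTo-+ (suc n) f g = trans (cong (_+ℤ (f (suc n) +ℤ g (suc n))) (sumTo-+ n f g))
                            (interchange (sumTo n f) (sumTo n g) (f (suc n)) (g (suc n)))
  where
  interchange : ∀ a b c d → (a +ℤ b) +ℤ (c +ℤ d) ≡ (a +ℤ c) +ℤ (b +ℤ d)
  interchange = solve-∀

-- g 0 ≡ 0ℤ makes the truncated indices n ∸ 1, n ∸ 2, n ∸ 3 harmless for n < 3.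
convolution-cubic : ∀ n (g c : ℕ → ℤ) → g 0 ≡ 0ℤ → (∀ e → c (4 + e) ≡ 0ℤ) →
  sumTo n (λ i → g i *ℤ c (n ∸ i))
    ≡ g n *ℤ c 0 +ℤ (g (n ∸ 1) *ℤ c 1 +ℤ (g (n ∸ 2) *ℤ c 2 +ℤ g (n ∸ 3) *ℤ c 3))
convolution-cubic zero    g c g₀ c₄ rewrite g₀ = refl
convolution-cubic (suc n) g c g₀ c₄ = begin
    sumTo n (λ i → g i *ℤ c (suc n ∸ i)) +ℤ g (suc n) *ℤ c (suc n ∸ suc n)
  ≡⟨ cong₂ _+ℤ_ (sumTo-cong n (λ i i≤n → cong (λ e → g i *ℤ c e) (+-∸-assoc 1 i≤n)))
                (cong (λ e → g (suc n) *ℤ c e) (n∸n≡0 n)) ⟩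
    sumTo n (λ i → g i *ℤ c (suc (n ∸ i))) +ℤ g (suc n) *ℤ c 0
  ≡⟨ cong (_+ℤ g (suc n) *ℤ c 0) (convolution-cubic n g (c ∘ suc) g₀ (c₄ ∘ suc)) ⟩
    (g n *ℤ c 1 +ℤ (g (n ∸ 1) *ℤ c 2 +ℤ (g (n ∸ 2) *ℤ c 3 +ℤ g (n ∸ 3) *ℤ c 4))) +ℤ g (suc n) *ℤ c 0
  ≡⟨ cong (λ x → (g n *ℤ c 1 +ℤ (g (n ∸ 1) *ℤ c 2 +ℤ (g (n ∸ 2) *ℤ c 3 +ℤ g (n ∸ 3) *ℤ x)))
                 +ℤ g (suc n) *ℤ c 0) (c₄ 0) ⟩
    (g n *ℤ c 1 +ℤ (g (n ∸ 1) *ℤ c 2 +ℤ (g (n ∸ 2) *ℤ c 3 +ℤ g (n ∸ 3) *ℤ 0ℤ))) +ℤ g (suc n) *ℤ c 0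
  ≡⟨ rotate (g (suc n)) (g n) (g (n ∸ 1)) (g (n ∸ 2)) (g (n ∸ 3)) (c 0) (c 1) (c 2) (c 3) ⟩
    g (suc n) *ℤ c 0 +ℤ (g n *ℤ c 1 +ℤ (g (n ∸ 1) *ℤ c 2 +ℤ g (n ∸ 2) *ℤ c 3))
  ∎
  where
  open ≡-Reasoning
  rotate : ∀ g₀ g₁ g₂ g₃ g₄ c₀ c₁ c₂ c₃ →
    (g₁ *ℤ c₁ +ℤ (g₂ *ℤ c₂ +ℤ (g₃ *ℤ c₃ +ℤ g₄ *ℤ 0ℤ))) +ℤ g₀ *ℤ c₀
      ≡ g₀ *ℤ c₀ +ℤ (g₁ *ℤ c₁ +ℤ (g₂ *ℤ c₂ +ℤ g₃ *ℤ c₃))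
  rotate = solve-∀

convolution-linear : ∀ n (g c : ℕ → ℤ) → g 0 ≡ 0ℤ → (∀ e → c (2 + e) ≡ 0ℤ) →
  sumTo n (λ i → g i *ℤ c (n ∸ i)) ≡ g n *ℤ c 0 +ℤ g (n ∸ 1) *ℤ c 1
convolution-linear n g c g₀ c₂ =
  trans (convolution-cubic n g c g₀ (λ e → c₂ (2 + e)))
        (trans (cong₂ (λ x y → g n *ℤ c 0 +ℤ (g (n ∸ 1) *ℤ c 1 +ℤ (g (n ∸ 2) *ℤ x +ℤ g (n ∸ 3) *ℤ y)))
                      (c₂ 0) (c₂ 1))
               (drop (g n) (g (n ∸ 1)) (g (n ∸ 2)) (g (n ∸ 3)) (c 0) (c 1)))
  where
  drop : ∀ a b d e x y → a *ℤ x +ℤ (b *ℤ y +ℤ (d *ℤ 0ℤ +ℤ e *ℤ 0ℤ)) ≡ a *ℤ x +ℤ b *ℤ y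
  drop = solve-∀

convolution-Den-y⁰ : ∀ n (g : ℕ → ℤ) → g 0 ≡ 0ℤ → sumTo n (λ i → g i *ℤ Den (n ∸ i) 0) ≡ g n
convolution-Den-y⁰ n g g₀ =
  trans (convolution-cubic n g (λ d → Den d 0) g₀ (λ _ → refl))
        (collect (g n) (g (n ∸ 1)) (g (n ∸ 2)) (g (n ∸ 3)))
  where
  collect : ∀ a b c d → a *ℤ 1ℤ +ℤ (b *ℤ 0ℤ +ℤ (c *ℤ 0ℤ +ℤ d *ℤ 0ℤ)) ≡ a
  collect = solve-∀

convolution-Den-y¹ : ∀ n (g : ℕ → ℤ) → g 0 ≡ 0ℤ →
  sumTo n (λ i → g i *ℤ Den (n ∸ i) 1) ≡ - (g (n ∸ 1) +ℤ (g (n ∸ 2) +ℤ g (n ∸ 3)))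
convolution-Den-y¹ n g g₀ =
  trans (convolution-cubic n g (λ d → Den d 1) g₀ (λ _ → refl))
        (collect (g n) (g (n ∸ 1)) (g (n ∸ 2)) (g (n ∸ 3)))
  where
  collect : ∀ a b c d → a *ℤ 0ℤ +ℤ (b *ℤ -1ℤ +ℤ (c *ℤ -1ℤ +ℤ d *ℤ -1ℤ)) ≡ - (b +ℤ (c +ℤ d))
  collect = solve-∀

Den-y² : ∀ d e → Den d (2 + e) ≡ 0ℤ
Den-y² 0 e = refl
Den-y² 1 e = refl
Den-y² 2 e = refl
Den-y² 3 e = refl
Den-y² (suc (suc (suc (suc d)))) e = refl

⊗-Den : ∀ (f : FPS) → (∀ k → f 0 k ≡ 0ℤ) → (∀ n → f n 0 ≡ 0ℤ) → ∀ n k →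
  (f ⊗ Den) n k ≡ f n k -ℤ (f (n ∸ 1) (k ∸ 1) +ℤ (f (n ∸ 2) (k ∸ 1) +ℤ f (n ∸ 3) (k ∸ 1)))
⊗-Den f f-x⁰ f-y⁰ n k = begin
    sumTo n (λ i → sumTo k (λ j → f i j *ℤ Den (n ∸ i) (k ∸ j)))
  ≡⟨ sumTo-cong n (λ i _ → convolution-linear k (f i) (Den (n ∸ i)) (f-y⁰ i) (Den-y² (n ∸ i))) ⟩
    sumTo n (λ i → f i k *ℤ Den (n ∸ i) 0 +ℤ f i (k ∸ 1) *ℤ Den (n ∸ i) 1)
  ≡⟨ sumTo-+ n (λ i → f i k *ℤ Den (n ∸ i) 0) (λ i → f i (k ∸ 1) *ℤ Den (n ∸ i) 1) ⟩
    sumTo n (λ i → f i k *ℤ Den (n ∸ i) 0) +ℤ sumTo n (λ i → f i (k ∸ 1) *ℤ Den (n ∸ i) 1)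
  ≡⟨ cong₂ _+ℤ_ (convolution-Den-y⁰ n (λ i → f i k) (f-x⁰ k))
                (convolution-Den-y¹ n (λ i → f i (k ∸ 1)) (f-x⁰ (k ∸ 1))) ⟩
    f n k -ℤ (f (n ∸ 1) (k ∸ 1) +ℤ (f (n ∸ 2) (k ∸ 1) +ℤ f (n ∸ 3) (k ∸ 1)))
  ∎
  where open ≡-Reasoning

mainTheorem8 : ∀ n k → (H ⊗ Den) n k ≡ Num n k
mainTheorem8 n k = begin
    (H ⊗ Den) n k
  ≡⟨ ⊗-Den H (λ _ → refl) H-y⁰ n k ⟩
    H n k -ℤ S
  ≡⟨ cong (_-ℤ S) (H-recurrence n k) ⟩
    (Num n k +ℤ S) -ℤ S
  ≡⟨ cancel (Num n k) S ⟩
    Num n k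
  ∎
  where
  open ≡-Reasoning
  S : ℤ
  S = H (n ∸ 1) (k ∸ 1) +ℤ (H (n ∸ 2) (k ∸ 1) +ℤ H (n ∸ 3) (k ∸ 1))
  cancel : ∀ a s → (a +ℤ s) -ℤ s ≡ a
  cancel = solve-∀
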